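{- In every optimal schedule for the preemptive problem $P|\textit{partition},\textit{prmp}|\sum_j C_j$, all jobs sharing the same resource are processed in shortest-processing-time order: if jobs $j$ and $j'$ share a resource $r\in R$ and $p_j<p_{j'}$, then $C_j<C_{j'}$. Furthermore, if $j$ and $j'$ share a resource and $C_j<C_{j'}$, then all parts of $j$ are processed before any part of $j'$.
   Context: An instance consists of $m\ge 1$ identical parallel machines, a finite set $J$ of jobs with processing times $p_j>0$, and a partition $R$ of $J$ into classes called resources; two jobs in the same class share a resource. In the preemptive problem $P|\textit{partition},\textit{prmp}|\sum_j C_j$, a schedule may interrupt a job at any time and resume it later, possibly on another machine, without loss of the processing already done: each job $j$ is processed in finitely many parts (maximal intervals of uninterrupted processing of $j$ on a single machine, of positive length) whose total length is $p_j$, all parts starting at time $\ge 0$. A schedule is feasible if no machine processes two things at the same time, no job is processed on two machines at the same time, and no two distinct jobs sharing a resource are processed at the same time. The completion time $C_j$ of job $j$ is the end of its last part. An optimal schedule is a feasible schedule minimizing $\sum_{j\in J}C_j$.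
   Formalization: The processing times $p_j$ and the start and end times of all parts are rational, and optimality is taken among schedules whose parts have rational start and end times. -}

module Defs where

open import Data.Nat using (ℕ)
open import Data.Fin using (Fin)
open import Data.Fin.Properties using (_≟_)
open import Data.List using (List; filter; foldr; length; lookup)
open import Data.Rational using (ℚ; 0ℚ; _+_; _-_; _⊔_; _≤_; _<_)
open import Data.Product using (_×_)
open import Relation.Binary.PropositionalEquality using (_≡_; _≢_)
open import Relation.Nullary using (¬_)

-- A part: job `job` is processed without interruption on machine `mach`
-- during the time interval [start , end).
record Part (n m : ℕ) : Set where
  constructor part
  field
    job   : Fin n
    mach  : Fin m
    start : ℚ
    end   : ℚ
open Part public

Schedule : ℕ → ℕ → Set
Schedule n m = List (Part n m)

module _ {n m : ℕ} where

  partsOf : Fin n → Schedule n m → List (Part n m)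
  partsOf j S = filter (λ q → job q ≟ j) S

  len : Part n m → ℚ
  len q = end q - start q

  processed : Fin n → Schedule n m → ℚ
  processed j S = foldr (λ q acc → len q + acc) 0ℚ (partsOf j S)

  completion : Fin n → Schedule n m → ℚ
  completion j S = foldr (λ q acc → end q ⊔ acc) 0ℚ (partsOf j S)

  Overlap : Part n m → Part n m → Set
  Overlap q q' = (start q < end q') × (start q' < end q)

-- Feasibility for processing times p and resource labelling res
-- (jobs j, j' share a resource iff res j ≡ res j').
Feasible : {n m k : ℕ} → (Fin n → ℚ) → (Fin n → Fin k) → Schedule n m → Set
Feasible {n} {m} p res S =
    (∀ (a : Fin (length S)) → (0ℚ ≤ start (lookup S a)) × (start (lookup S a) < end (lookup S a)))
  × (∀ (j : Fin n) → processed j S ≡ p j)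
  × (∀ (a b : Fin (length S)) → a ≢ b →
       (mach (lookup S a) ≡ mach (lookup S b) → ¬ Overlap (lookup S a) (lookup S b))
     × (job (lookup S a) ≡ job (lookup S b) → ¬ Overlap (lookup S a) (lookup S b))
     × (job (lookup S a) ≢ job (lookup S b) →
          res (job (lookup S a)) ≡ res (job (lookup S b)) → ¬ Overlap (lookup S a) (lookup S b)))

sumFin : (n : ℕ) → (Fin n → ℚ) → ℚ
sumFin ℕ.zero f = 0ℚ
sumFin (ℕ.suc n) f = f Fin.zero + sumFin n (λ i → f (Fin.suc i))

totalCompletion : {n m : ℕ} → Schedule n m → ℚ
totalCompletion {n} S = sumFin n (λ j → completion j S)

Optimal : {n m k : ℕ} → (Fin n → ℚ) → (Fin n → Fin k) → Schedule n m → Set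
Optimal {n} {m} p res S =
  Feasible p res S × (∀ (S' : Schedule n m) → Feasible p res S' → totalCompletion S ≤ totalCompletion S')

{-# OPTIONS --safe #-}
module Submission where

-- Let j and j′ share a resource in an optimal schedule S. Mark some parts of j or j′ whose total
-- length W exceeds p j, and cut each marked part at the fraction μ = p j / W of its length, giving
-- the front piece to j and the back piece to j′; the unmarked parts of j are handed to j′. Every
-- piece lies inside its original part and j, j′ share a resource, so the result is feasible: j
-- receives μ W = p j and j′ the rest of what the two jobs had. Each piece of j ends before its
-- marked part does, j′ finishes by max (C j) (C j′), and no other job is affected.
--   If p j < p j′ but C j′ ≤ C j, mark the parts of j′: now j finishes before C j′ and j′ by C j.
--   If C j < C j′ but a part q′ of j′ starts before a part q of j ends, then q′ ends before q
-- starts, hence by C j. Mark the parts of j and the parts of j′ ending by C j (q′ among them, so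
-- W > p j): now j finishes before C j while j′ still finishes by C j′.
-- Either way the total completion time drops, contradicting optimality.

open import Defs
open import Data.Nat using (ℕ; _≥_; zero; suc)
open import Data.Fin using (Fin; zero; suc)
open import Data.Fin.Properties using (_≟_; suc-injective)
import Data.Fin.Permutation as Permutation
open import Data.Fin.Permutation.Components using (transpose)
open import Data.List using (List; []; _∷_; [_]; _++_; filter; foldr; lookup; concatMap)
open import Data.List.Properties using (filter-++; filter-accept; filter-reject)
open import Data.List.Relation.Unary.All as All using (All; []; _∷_)
import Data.List.Relation.Unary.All.Properties as All
open import Data.List.Relation.Unary.AllPairs using (AllPairs; []; _∷_)
import Data.List.Relation.Unary.AllPairs.Properties as AllPairs
open import Data.List.Relation.Unary.Any using (here; there; index)
open import Data.List.Relation.Unary.Any.Properties using (lookup-index)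
open import Data.List.Membership.Propositional using (_∈_)
open import Data.List.Membership.Propositional.Properties
  using (∈-lookup; ∈-++⁻; ∈-filter⁻; ∈-filter⁺)
open import Data.Rational
  using (ℚ; 0ℚ; 1ℚ; _+_; _-_; -_; _*_; _⊔_; _≤_; _<_; 1/_; NonZero; positive)
open import Data.Rational.Properties
  using ( ≤-refl; ≤-reflexive; ≤-trans; <⇒≤; <-irrefl; <-trans; <-≤-trans; ≤-<-trans; ≮⇒≥; ≰⇒>; _≤?_
        ; +-identityˡ; +-identityʳ; +-assoc; +-inverseʳ
        ; +-mono-≤; +-mono-<-≤; +-mono-≤-<; +-monoʳ-≤; +-monoˡ-<; +-monoʳ-<
        ; *-zeroˡ; *-zeroʳ; *-identityˡ; *-identityʳ; *-assoc; *-distribˡ-+; *-inverseˡ; *-inverseʳ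
        ; *-monoˡ-<-pos; *-monoʳ-<-pos; pos⇒nonZero; 1/pos⇒pos; positive⁻¹
        ; ⊔-sel; ⊔-lub; p≤p⊔q; p≤q⊔p; p≤q⇒p≤r⊔q; p≤q⇒p⊔q≡q; p≥q⇒p⊔q≡p
        ; +-0-group; +-0-commutativeMonoid )
open import Data.Rational.Solver using (module +-*-Solver)
open import Algebra.Properties.Group +-0-group using (∙-cancelˡ)
open import Algebra.Properties.CommutativeMonoid.Sum +-0-commutativeMonoid
  using (sum; sum-permute)
open import Data.Product using (∃-syntax; _×_; _,_; proj₁; proj₂)
open import Data.Sum using (_⊎_; inj₁; inj₂)
open import Data.Empty using (⊥-elim)
open import Function using (_∘_)
open import Level using (0ℓ)
open import Relation.Binary.Definitions using (Symmetric)
open import Relation.Nullary using (¬_; yes; no; _×-dec_; _⊎-dec_)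
open import Relation.Unary using (Pred; Decidable; _⊆_)
open import Relation.Binary.PropositionalEquality
  using (_≡_; _≢_; refl; sym; trans; cong; cong₂; subst; subst₂; module ≡-Reasoning)

module _ {A : Set} where

  lookup⇒All : ∀ {P : A → Set} xs → (∀ a → P (lookup xs a)) → All P xs
  lookup⇒All {P} xs h = All.tabulate (λ x∈xs → subst P (sym (lookup-index x∈xs)) (h (index x∈xs)))

  lookup⇒AllPairs : ∀ {R : A → A → Set} xs →
    (∀ a b → a ≢ b → R (lookup xs a) (lookup xs b)) → AllPairs R xs
  lookup⇒AllPairs [] h = []
  lookup⇒AllPairs (x ∷ xs) h =
    lookup⇒All xs (λ b → h zero (suc b) λ ()) ∷
    lookup⇒AllPairs xs (λ a b a≢b → h (suc a) (suc b) (a≢b ∘ suc-injective))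

  AllPairs⇒lookup : ∀ {R : A → A → Set} → Symmetric R → ∀ {xs} → AllPairs R xs →
    ∀ a b → a ≢ b → R (lookup xs a) (lookup xs b)
  AllPairs⇒lookup R-sym (_ ∷ _)   zero    zero    a≢b = ⊥-elim (a≢b refl)
  AllPairs⇒lookup R-sym (Rx ∷ _)  zero    (suc b) _   = All.lookup Rx (∈-lookup b)
  AllPairs⇒lookup R-sym (Rx ∷ _)  (suc a) zero    _   = R-sym (All.lookup Rx (∈-lookup a))
  AllPairs⇒lookup R-sym (_ ∷ Rxs) (suc a) (suc b) a≢b =
    AllPairs⇒lookup R-sym Rxs a b (a≢b ∘ cong suc)

  ∈-concatMap⁻ : ∀ {B : Set} (f : A → List B) xs {v} → v ∈ concatMap f xs →
    ∃[ x ] x ∈ xs × v ∈ f x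
  ∈-concatMap⁻ f (x ∷ xs) v∈ with ∈-++⁻ (f x) v∈
  ... | inj₁ v∈fx = x , here refl , v∈fx
  ... | inj₂ v∈rest with ∈-concatMap⁻ f xs v∈rest
  ...   | y , y∈xs , v∈fy = y , there y∈xs , v∈fy

record Additive {A : Set} (Φ : List A → ℚ) : Set where
  constructor additive
  field
    []-zero : Φ [] ≡ 0ℚ
    ++-sum  : ∀ xs ys → Φ (xs ++ ys) ≡ Φ xs + Φ ys

open Additive

module _ {A : Set} {Φ Ψ : List A → ℚ} where

  additive-+ : Additive Φ → Additive Ψ → Additive (λ L → Φ L + Ψ L)
  additive-+ (additive Φ[] Φ++) (additive Ψ[] Ψ++) = additive
    (trans (cong₂ _+_ Φ[] Ψ[]) (+-identityˡ 0ℚ))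
    λ xs ys →
      trans (cong₂ _+_ (Φ++ xs ys) (Ψ++ xs ys)) (interchange (Φ xs) (Φ ys) (Ψ xs) (Ψ ys))
    where
    open +-*-Solver
    interchange : ∀ a b c d → (a + b) + (c + d) ≡ (a + c) + (b + d)
    interchange = solve 4 (λ a b c d → (a :+ b) :+ (c :+ d) := (a :+ c) :+ (b :+ d)) refl

module _ {A : Set} {Φ : List A → ℚ} where

  additive-* : ∀ μ → Additive Φ → Additive (λ L → μ * Φ L)
  additive-* μ (additive Φ[] Φ++) = additive
    (trans (cong (μ *_) Φ[]) (*-zeroʳ μ))
    λ xs ys → trans (cong (μ *_) (Φ++ xs ys)) (*-distribˡ-+ μ (Φ xs) (Φ ys))

module _ {A B : Set} {Φ : List B → ℚ} {Ψ : List A → ℚ} where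

  additive-concatMap : Additive Φ → Additive Ψ → (f : A → List B) →
    (∀ x → Φ (f x) ≡ Ψ [ x ]) → ∀ xs → Φ (concatMap f xs) ≡ Ψ xs
  additive-concatMap ΦA ΨA f local [] = trans ([]-zero ΦA) (sym ([]-zero ΨA))
  additive-concatMap ΦA ΨA f local (x ∷ xs) = begin
    Φ (f x ++ concatMap f xs)     ≡⟨ ++-sum ΦA (f x) (concatMap f xs) ⟩
    Φ (f x) + Φ (concatMap f xs)  ≡⟨ cong₂ _+_ (local x) (additive-concatMap ΦA ΨA f local xs) ⟩
    Ψ [ x ] + Ψ xs                ≡⟨ ++-sum ΨA [ x ] xs ⟨
    Ψ (x ∷ xs)                    ∎
    where open ≡-Reasoning

-- Durations and completion times

module _ {n m : ℕ} where

  Proper : Part n m → Set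
  Proper q = (0ℚ ≤ start q) × (start q < end q)

  -- processed i L and completion i L are, by definition, duration and latestEnd of partsOf i L.
  duration : List (Part n m) → ℚ
  duration = foldr (λ q acc → len q + acc) 0ℚ

  latestEnd : List (Part n m) → ℚ
  latestEnd = foldr (λ q acc → end q ⊔ acc) 0ℚ

  duration-++ : ∀ xs ys → duration (xs ++ ys) ≡ duration xs + duration ys
  duration-++ []       ys = sym (+-identityˡ (duration ys))
  duration-++ (x ∷ xs) ys =
    trans (cong (len x +_) (duration-++ xs ys)) (sym (+-assoc (len x) (duration xs) (duration ys)))

  duration-filter-additive : ∀ {P : Pred (Part n m) 0ℓ} (P? : Decidable P) →
    Additive (duration ∘ filter P?)
  duration-filter-additive P? = additive refl λ xs ys →
    trans (cong duration (filter-++ P? xs ys)) (duration-++ (filter P? xs) (filter P? ys))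

  processed-additive : ∀ i → Additive (processed i)
  processed-additive i = duration-filter-additive (λ q → job q ≟ i)

  processed-accept : ∀ {i} u → job u ≡ i → processed i [ u ] ≡ len u
  processed-accept {i} u ju = trans (cong duration (filter-accept (λ q → job q ≟ i) ju)) (+-identityʳ _)

  processed-reject : ∀ {i} u → job u ≢ i → processed i [ u ] ≡ 0ℚ
  processed-reject {i} u ju = cong duration (filter-reject (λ q → job q ≟ i) ju)

  len-pos : ∀ q → Proper q → 0ℚ < len q
  len-pos q (_ , s<e) = subst (_< len q) (+-inverseʳ (start q)) (+-monoˡ-< (- start q) s<e)

  ≤-+-nonneg : ∀ {a b} c → 0ℚ ≤ c → a ≤ b → a ≤ c + b
  ≤-+-nonneg {a} c 0≤c a≤b = subst (_≤ c + _) (+-identityˡ a) (+-mono-≤ 0≤c a≤b)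

  module _ {P Q : Pred (Part n m) 0ℓ} (Q? : Decidable Q) (P? : Decidable P) (Q⊆P : Q ⊆ P) where

    duration-filter-mono : ∀ {L} → All Proper L → duration (filter Q? L) ≤ duration (filter P? L)
    duration-filter-mono []                       = ≤-refl
    duration-filter-mono {x ∷ L} (px ∷ proper) with Q? x | P? x
    ... | yes _  | yes _  = +-monoʳ-≤ (len x) (duration-filter-mono proper)
    ... | yes Qx | no ¬Px = ⊥-elim (¬Px (Q⊆P Qx))
    ... | no _   | yes _  = ≤-+-nonneg (len x) (<⇒≤ (len-pos x px)) (duration-filter-mono proper)
    ... | no _   | no _   = duration-filter-mono proper

    duration-filter-< : ∀ {L x} → All Proper L → x ∈ L → P x → ¬ Q x →
      duration (filter Q? L) < duration (filter P? L)
    duration-filter-< {x ∷ L} (px ∷ proper) (here refl) Px ¬Qx with Q? x | P? x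
    ... | yes Qx | _      = ⊥-elim (¬Qx Qx)
    ... | no _   | no ¬Px = ⊥-elim (¬Px Px)
    ... | no _   | yes _  = subst (_< len x + _) (+-identityˡ _)
                              (+-mono-<-≤ (len-pos x px) (duration-filter-mono proper))
    duration-filter-< {y ∷ L} (py ∷ proper) (there x∈L) Px ¬Qx with Q? y | P? y
    ... | yes _  | yes _  = +-monoʳ-< (len y) (duration-filter-< proper x∈L Px ¬Qx)
    ... | yes Qy | no ¬Py = ⊥-elim (¬Py (Q⊆P Qy))
    ... | no _   | yes _  = subst (_< len y + _) (+-identityˡ _)
                              (+-mono-≤-< (<⇒≤ (len-pos y py)) (duration-filter-< proper x∈L Px ¬Qx))
    ... | no _   | no _   = duration-filter-< proper x∈L Px ¬Qx

  latestEnd-nonneg : ∀ M → 0ℚ ≤ latestEnd M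
  latestEnd-nonneg []      = ≤-refl
  latestEnd-nonneg (x ∷ M) = p≤q⇒p≤r⊔q (end x) (latestEnd-nonneg M)

  end≤latestEnd : ∀ {u M} → u ∈ M → end u ≤ latestEnd M
  end≤latestEnd {M = x ∷ M} (here refl) = p≤p⊔q (end x) (latestEnd M)
  end≤latestEnd {M = x ∷ M} (there u∈M) = p≤q⇒p≤r⊔q (end x) (end≤latestEnd u∈M)

  latestEnd-≤ : ∀ {c} M → 0ℚ ≤ c → (∀ {u} → u ∈ M → end u ≤ c) → latestEnd M ≤ c
  latestEnd-≤ []      0≤c bound = 0≤c
  latestEnd-≤ (x ∷ M) 0≤c bound = ⊔-lub (bound (here refl)) (latestEnd-≤ M 0≤c (bound ∘ there))

  latestEnd-< : ∀ {c} M → 0ℚ < c → (∀ {u} → u ∈ M → end u < c) → latestEnd M < c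
  latestEnd-< []      0<c bound = 0<c
  latestEnd-< (x ∷ M) 0<c bound with ⊔-sel (end x) (latestEnd M)
  ... | inj₁ ≡end    rewrite ≡end    = bound (here refl)
  ... | inj₂ ≡latest rewrite ≡latest = latestEnd-< M 0<c (bound ∘ there)

  latestEnd-pos : ∀ {M} → All Proper M → 0ℚ < duration M → 0ℚ < latestEnd M
  latestEnd-pos {[]}    _                 0<0 = ⊥-elim (<-irrefl refl 0<0)
  latestEnd-pos {x ∷ M} ((0≤s , s<e) ∷ _) _   =
    ≤-<-trans 0≤s (<-≤-trans s<e (end≤latestEnd {M = x ∷ M} (here refl)))

  ∈-partsOf⁻ : ∀ (i : Fin n) (L : Schedule n m) {u} →
    u ∈ partsOf i L → u ∈ L × job u ≡ i
  ∈-partsOf⁻ i L = ∈-filter⁻ (λ q → job q ≟ i) {xs = L}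

  module _ {i : Fin n} where

    end≤completion : ∀ {u L} → u ∈ L → job u ≡ i → end u ≤ completion i L
    end≤completion u∈L ju = end≤latestEnd (∈-filter⁺ (λ q → job q ≟ i) u∈L ju)

    completion-≤ : ∀ {c} L → 0ℚ ≤ c → (∀ {u} → u ∈ L → job u ≡ i → end u ≤ c) →
      completion i L ≤ c
    completion-≤ L 0≤c bound =
      latestEnd-≤ (partsOf i L) 0≤c (λ u∈ → let u∈L , ju = ∈-partsOf⁻ i L u∈ in bound u∈L ju)

    completion-< : ∀ {c} L → 0ℚ < c → (∀ {u} → u ∈ L → job u ≡ i → end u < c) →
      completion i L < c
    completion-< L 0<c bound =
      latestEnd-< (partsOf i L) 0<c (λ u∈ → let u∈L , ju = ∈-partsOf⁻ i L u∈ in bound u∈L ju)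

    completion-pos : ∀ {L} → All Proper L → 0ℚ < processed i L → 0ℚ < completion i L
    completion-pos proper = latestEnd-pos (All.filter⁺ (λ q → job q ≟ i) proper)

-- Sums over Fin n

sumFin≡sum : ∀ n f → sumFin n f ≡ sum f
sumFin≡sum zero    f = refl
sumFin≡sum (suc n) f = cong (f zero +_) (sumFin≡sum n (f ∘ suc))

sumFin-transpose : ∀ n g (a b : Fin n) → sumFin n (g ∘ transpose a b) ≡ sumFin n g
sumFin-transpose n g a b = begin
  sumFin n (g ∘ transpose a b)  ≡⟨ sumFin≡sum n (g ∘ transpose a b) ⟩
  sum (g ∘ transpose a b)       ≡⟨ sum-permute g (Permutation.transpose a b) ⟨
  sum g                         ≡⟨ sumFin≡sum n g ⟨
  sumFin n g                    ∎
  where open ≡-Reasoning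

sumFin-mono-≤ : ∀ n {f g : Fin n → ℚ} → (∀ i → f i ≤ g i) → sumFin n f ≤ sumFin n g
sumFin-mono-≤ zero    f≤g = ≤-refl
sumFin-mono-≤ (suc n) f≤g = +-mono-≤ (f≤g zero) (sumFin-mono-≤ n (f≤g ∘ suc))

sumFin-mono-< : ∀ n {f g : Fin n → ℚ} → (∀ i → f i ≤ g i) → ∀ a → f a < g a →
  sumFin n f < sumFin n g
sumFin-mono-< (suc n) f≤g zero    fa<ga = +-mono-<-≤ fa<ga (sumFin-mono-≤ n (f≤g ∘ suc))
sumFin-mono-< (suc n) f≤g (suc a) fa<ga =
  +-mono-≤-< (f≤g zero) (sumFin-mono-< n (f≤g ∘ suc) a fa<ga)

module _ (n : ℕ) {f g : Fin n → ℚ} {a b : Fin n}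
         (others : ∀ i → i ≢ a → i ≢ b → f i ≤ g i) where

  sumFin-<-pair : f a < g a → f b ≤ g b → sumFin n f < sumFin n g
  sumFin-<-pair fa<ga fb≤gb = sumFin-mono-< n pointwise a fa<ga
    where
    pointwise : ∀ i → f i ≤ g i
    pointwise i with i ≟ a | i ≟ b
    ... | yes refl | _        = <⇒≤ fa<ga
    ... | no _     | yes refl = fb≤gb
    ... | no i≢a   | no i≢b   = others i i≢a i≢b

  sumFin-<-swap : f a < g b → f b ≤ g a → sumFin n f < sumFin n g
  sumFin-<-swap fa<gb fb≤ga =
    subst (sumFin n f <_) (sumFin-transpose n g a b) (sumFin-mono-< n pointwise a strict)
    where
    pointwise : ∀ i → f i ≤ g (transpose a b i)
    pointwise i with i ≟ a
    ... | yes refl = <⇒≤ fa<gb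
    ... | no i≢a with i ≟ b
    ...   | yes refl = fb≤ga
    ...   | no i≢b   = others i i≢a i≢b
    strict : f a < g (transpose a b a)
    strict with a ≟ a
    ... | yes _   = fa<gb
    ... | no a≢a = ⊥-elim (a≢a refl)

-- Feasibility

module _ {n m k : ℕ} (res : Fin n → Fin k) where

  Compatible : Part n m → Part n m → Set
  Compatible q q' =
      (mach q ≡ mach q' → ¬ Overlap q q')
    × (job q ≡ job q' → ¬ Overlap q q')
    × (job q ≢ job q' → res (job q) ≡ res (job q') → ¬ Overlap q q')

  compatible-sym : Symmetric Compatible
  compatible-sym {q} {q'} (same-mach , same-job , same-res) =
    (λ e → same-mach (sym e) ∘ flip) ,
    (λ e → same-job (sym e) ∘ flip) ,
    (λ ne r → same-res (ne ∘ sym) (sym r) ∘ flip)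
    where
    flip : Overlap q' q → Overlap q q'
    flip (a , b) = b , a

  _⊑_ : Part n m → Part n m → Set
  u ⊑ x = (mach u ≡ mach x) × (res (job u) ≡ res (job x))
        × (start x ≤ start u) × (end u ≤ end x)

  compatible-⊑ : ∀ {u v x y} → u ⊑ x → v ⊑ y → Compatible x y → Compatible u v
  compatible-⊑ {u} {v} {x} {y} (mu , ru , su , eu) (mv , rv , sv , ev)
               (same-mach , same-job , same-res) =
    (λ e → same-mach (trans (sym mu) (trans e mv)) ∘ widen) ,
    (λ e → resource-conflict (cong res e)) ,
    (λ _ → resource-conflict)
    where
    widen : Overlap u v → Overlap x y
    widen (a , b) = ≤-<-trans su (<-≤-trans a ev) , ≤-<-trans sv (<-≤-trans b eu)
    resource-conflict : res (job u) ≡ res (job v) → ¬ Overlap u v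
    resource-conflict r with job x ≟ job y
    ... | yes e = same-job e ∘ widen
    ... | no ne = same-res ne (trans (sym ru) (trans r rv)) ∘ widen

module _ {n m k : ℕ} {p : Fin n → ℚ} (res : Fin n → Fin k) (S : Schedule n m)
         (feasible : Feasible p res S) where

  feasible-proper : All Proper S
  feasible-proper = lookup⇒All S (proj₁ feasible)

  feasible-pairwise : AllPairs (Compatible res) S
  feasible-pairwise = lookup⇒AllPairs S (proj₂ (proj₂ feasible))

  feasible-compatible : ∀ {u v} → u ∈ S → v ∈ S → u ≢ v → Compatible res u v
  feasible-compatible u∈S v∈S u≢v =
    subst₂ (Compatible res) (sym (lookup-index u∈S)) (sym (lookup-index v∈S))
      (proj₂ (proj₂ feasible) (index u∈S) (index v∈S) λ e →
        u≢v (trans (lookup-index u∈S) (trans (cong (lookup S) e) (sym (lookup-index v∈S)))))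

feasible-intro : ∀ {n m k} {p : Fin n → ℚ} {res : Fin n → Fin k} {S : Schedule n m} →
  All Proper S → (∀ i → processed i S ≡ p i) → AllPairs (Compatible res) S → Feasible p res S
feasible-intro {res = res} proper processed-S pairwise =
  (λ a → All.lookup proper (∈-lookup a)) , processed-S , AllPairs⇒lookup (compatible-sym res) pairwise

-- The exchange

module Fraction {a b : ℚ} (a>0 : 0ℚ < a) (a<b : a < b) where

  private
    b>0 : 0ℚ < b
    b>0 = <-trans a>0 a<b
    instance
      b≢0 : NonZero b
      b≢0 = pos⇒nonZero b {{positive b>0}}
    1/b>0 : 0ℚ < 1/ b
    1/b>0 = positive⁻¹ (1/ b) {{1/pos⇒pos b {{positive b>0}}}}

  μ : ℚ
  μ = a * 1/ b

  μ>0 : 0ℚ < μ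
  μ>0 = subst (_< μ) (*-zeroˡ (1/ b)) (*-monoˡ-<-pos (1/ b) {{positive 1/b>0}} a>0)

  μ<1 : μ < 1ℚ
  μ<1 = subst (μ <_) (*-inverseʳ b) (*-monoˡ-<-pos (1/ b) {{positive 1/b>0}} a<b)

  μ*b≡a : μ * b ≡ a
  μ*b≡a = trans (*-assoc a (1/ b) b) (trans (cong (a *_) (*-inverseˡ b)) (*-identityʳ a))

module Exchange {n m k : ℕ} (res : Fin n → Fin k)
  {j j' : Fin n} (j≢j' : j ≢ j') (same-resource : res j ≡ res j')
  {Marked : Pred (Part n m) 0ℓ} (marked? : Decidable Marked)
  (marked-job : ∀ x → Marked x → job x ≡ j ⊎ job x ≡ j')
  {μ : ℚ} (μ>0 : 0ℚ < μ) (μ<1 : μ < 1ℚ) where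

  cut : Part n m → ℚ
  cut x = start x + μ * len x

  front back : Part n m → Part n m
  front x = part j  (mach x) (start x) (cut x)
  back  x = part j' (mach x) (cut x)   (end x)

  data Exchanged (x : Part n m) : List (Part n m) → Set where
    split   : Marked x → Exchanged x (front x ∷ back x ∷ [])
    relabel : ¬ Marked x → job x ≡ j → Exchanged x (record x { job = j' } ∷ [])
    keep    : ¬ Marked x → job x ≢ j → Exchanged x (x ∷ [])

  exchange : Part n m → List (Part n m)
  exchange x with marked? x | job x ≟ j
  ... | yes _ | _     = front x ∷ back x ∷ []
  ... | no _  | yes _ = record x { job = j' } ∷ []
  ... | no _  | no _  = x ∷ []

  exchanged : ∀ x → Exchanged x (exchange x)
  exchanged x with marked? x | job x ≟ j
  ... | yes mx  | _       = split mx
  ... | no ¬mx  | yes jx  = relabel ¬mx jx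
  ... | no ¬mx  | no jx≢j = keep ¬mx jx≢j

  exchangeAll : Schedule n m → Schedule n m
  exchangeAll = concatMap exchange

  private
    open +-*-Solver

    cut-len : ∀ (x : Part n m) → cut x - start x ≡ μ * len x
    cut-len x = solve 3 (λ s e u → (s :+ u :* (e :- s)) :- s := u :* (e :- s))
                  refl (start x) (end x) μ

    split-len : ∀ (x : Part n m) → (cut x - start x) + (end x - cut x) ≡ len x
    split-len x =
      solve 3 (λ s e u → ((s :+ u :* (e :- s)) :- s) :+ (e :- (s :+ u :* (e :- s))) := e :- s)
        refl (start x) (end x) μ

    start+len : ∀ (x : Part n m) → start x + len x ≡ end x
    start+len x = solve 2 (λ s e → s :+ (e :- s) := e) refl (start x) (end x)

  start<cut : ∀ (x : Part n m) → Proper x → start x < cut x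
  start<cut x px = subst (_< cut x) (+-identityʳ (start x)) (+-monoʳ-< (start x) μ*len>0)
    where
    μ*len>0 : 0ℚ < μ * len x
    μ*len>0 = subst (_< μ * len x) (*-zeroʳ μ) (*-monoʳ-<-pos μ {{positive μ>0}} (len-pos x px))

  cut<end : ∀ (x : Part n m) → Proper x → cut x < end x
  cut<end x px = subst (cut x <_) (start+len x) (+-monoʳ-< (start x) μ*len<len)
    where
    μ*len<len : μ * len x < len x
    μ*len<len = subst (μ * len x <_) (*-identityˡ (len x))
                  (*-monoˡ-<-pos (len x) {{positive (len-pos x px)}} μ<1)

  shared-resource : ∀ (x : Part n m) → job x ≡ j ⊎ job x ≡ j' → res j' ≡ res (job x)
  shared-resource _ (inj₁ refl) = sym same-resource
  shared-resource _ (inj₂ refl) = refl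

  distinct-job : ∀ {i} (x : Part n m) → i ≢ j → i ≢ j' → job x ≡ j ⊎ job x ≡ j' → job x ≢ i
  distinct-job x i≢j _    (inj₁ jx) e = i≢j (trans (sym e) jx)
  distinct-job x _   i≢j' (inj₂ jx) e = i≢j' (trans (sym e) jx)

  module _ {x : Part n m} (px : Proper x) where

    piece-⊑ : ∀ {L u} → Exchanged x L → u ∈ L → Proper u × _⊑_ res u x
    piece-⊑ (split mx) (here refl) =
      (proj₁ px , start<cut x px) , refl , trans same-resource (shared-resource x (marked-job x mx)) ,
      ≤-refl , <⇒≤ (cut<end x px)
    piece-⊑ (split mx) (there (here refl)) =
      (≤-trans (proj₁ px) (<⇒≤ (start<cut x px)) , cut<end x px) , refl ,
      shared-resource x (marked-job x mx) , <⇒≤ (start<cut x px) , ≤-refl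
    piece-⊑ (relabel _ jx) (here refl) = px , refl , shared-resource x (inj₁ jx) , ≤-refl , ≤-refl
    piece-⊑ (keep _ _)     (here refl) = px , refl , refl , ≤-refl , ≤-refl

    piece-cases : ∀ {L u} → Exchanged x L → u ∈ L →
        (u ≡ x × job x ≢ j)
      ⊎ (job u ≡ j × Marked x × end u < end x)
      ⊎ (job u ≡ j' × (job x ≡ j ⊎ job x ≡ j'))
    piece-cases (split mx)     (here refl)         = inj₂ (inj₁ (refl , mx , cut<end x px))
    piece-cases (split mx)     (there (here refl)) = inj₂ (inj₂ (refl , marked-job x mx))
    piece-cases (relabel _ jx) (here refl)         = inj₂ (inj₂ (refl , inj₁ jx))
    piece-cases (keep _ jx≢j)  (here refl)         = inj₁ (refl , jx≢j)

  exchanged-pairwise : ∀ {x L} → Exchanged x L → AllPairs (Compatible res) L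
  exchanged-pairwise {x} (split _) =
    (((λ _ → disjoint) , (λ _ → disjoint) , (λ _ _ → disjoint)) ∷ []) ∷ [] ∷ []
    where
    disjoint : ¬ Overlap (front x) (back x)
    disjoint (_ , cut<cut) = <-irrefl refl cut<cut
  exchanged-pairwise (relabel _ _) = [] ∷ []
  exchanged-pairwise (keep _ _)    = [] ∷ []

  processed-exchanged-other : ∀ {i x L} → i ≢ j → i ≢ j' → Exchanged x L →
    processed i L ≡ processed i [ x ]
  processed-exchanged-other {i} {x} i≢j i≢j' (split mx) = begin
    processed i (front x ∷ back x ∷ [])              ≡⟨ ++-sum (processed-additive i) [ front x ] [ back x ] ⟩
    processed i [ front x ] + processed i [ back x ] ≡⟨ cong₂ _+_ (processed-reject (front x) (i≢j ∘ sym))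
                                                                  (processed-reject (back x) (i≢j' ∘ sym)) ⟩
    0ℚ + 0ℚ                                          ≡⟨ +-identityʳ 0ℚ ⟩
    0ℚ                                               ≡⟨ processed-reject x
                                                          (distinct-job x i≢j i≢j' (marked-job x mx)) ⟨
    processed i [ x ]                                ∎
    where open ≡-Reasoning
  processed-exchanged-other {x = x} i≢j i≢j' (relabel _ jx) =
    trans (processed-reject (record x { job = j' }) (i≢j' ∘ sym))
          (sym (processed-reject x (distinct-job x i≢j i≢j' (inj₁ jx))))
  processed-exchanged-other i≢j i≢j' (keep _ _) = refl

  pairProcessed : Schedule n m → ℚ
  pairProcessed L = processed j L + processed j' L

  pairProcessed-additive : Additive pairProcessed
  pairProcessed-additive = additive-+ (processed-additive j) (processed-additive j')

  pairProcessed-[] : ∀ u → job u ≡ j ⊎ job u ≡ j' → pairProcessed [ u ] ≡ len u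
  pairProcessed-[] u (inj₁ ju) =
    trans (cong₂ _+_ (processed-accept u ju) (processed-reject u (j≢j' ∘ trans (sym ju))))
          (+-identityʳ (len u))
  pairProcessed-[] u (inj₂ ju) =
    trans (cong₂ _+_ (processed-reject u (j≢j' ∘ sym ∘ trans (sym ju))) (processed-accept u ju))
          (+-identityˡ (len u))

  pairProcessed-exchanged : ∀ {x L} → Exchanged x L → pairProcessed L ≡ pairProcessed [ x ]
  pairProcessed-exchanged {x} (split mx) = begin
    pairProcessed (front x ∷ back x ∷ [])                ≡⟨ ++-sum pairProcessed-additive
                                                                       [ front x ] [ back x ] ⟩
    pairProcessed [ front x ] + pairProcessed [ back x ] ≡⟨ cong₂ _+_ (pairProcessed-[] (front x) (inj₁ refl))
                                                                      (pairProcessed-[] (back x) (inj₂ refl)) ⟩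
    len (front x) + len (back x)                         ≡⟨ split-len x ⟩
    len x                                                ≡⟨ pairProcessed-[] x (marked-job x mx) ⟨
    pairProcessed [ x ]                                  ∎
    where open ≡-Reasoning
  pairProcessed-exchanged {x} (relabel _ jx) =
    trans (pairProcessed-[] (record x { job = j' }) (inj₂ refl)) (sym (pairProcessed-[] x (inj₁ jx)))
  pairProcessed-exchanged (keep _ _) = refl

  processed-j-exchanged : ∀ {x L} → Exchanged x L → processed j L ≡ μ * duration (filter marked? [ x ])
  processed-j-exchanged {x} (split mx) = begin
    processed j (front x ∷ back x ∷ [])              ≡⟨ ++-sum (processed-additive j) [ front x ] [ back x ] ⟩
    processed j [ front x ] + processed j [ back x ] ≡⟨ cong₂ _+_ (processed-accept (front x) refl)
                                                                  (processed-reject (back x) (j≢j' ∘ sym)) ⟩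
    len (front x) + 0ℚ                               ≡⟨ +-identityʳ _ ⟩
    len (front x)                                    ≡⟨ cut-len x ⟩
    μ * len x                                        ≡⟨ cong (μ *_) (+-identityʳ (len x)) ⟨
    μ * duration [ x ]                               ≡⟨ cong (λ L → μ * duration L) (filter-accept marked? mx) ⟨
    μ * duration (filter marked? [ x ])              ∎
    where open ≡-Reasoning
  processed-j-exchanged {x} (relabel ¬mx _) = begin
    processed j [ record x { job = j' } ]  ≡⟨ processed-reject (record x { job = j' }) (j≢j' ∘ sym) ⟩
    0ℚ                                     ≡⟨ *-zeroʳ μ ⟨
    μ * 0ℚ                                 ≡⟨ cong (λ L → μ * duration L) (filter-reject marked? ¬mx) ⟨
    μ * duration (filter marked? [ x ])    ∎
    where open ≡-Reasoning
  processed-j-exchanged {x} (keep ¬mx jx≢j) = begin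
    processed j [ x ]                    ≡⟨ processed-reject x jx≢j ⟩
    0ℚ                                   ≡⟨ *-zeroʳ μ ⟨
    μ * 0ℚ                               ≡⟨ cong (λ L → μ * duration L) (filter-reject marked? ¬mx) ⟨
    μ * duration (filter marked? [ x ])  ∎
    where open ≡-Reasoning

  module _ {S : Schedule n m} (proper : All Proper S) where

    private
      origin : ∀ {u} → u ∈ exchangeAll S → ∃[ x ] x ∈ S × u ∈ exchange x
      origin = ∈-concatMap⁻ exchange S

      end-inside : ∀ {x u} → x ∈ S → u ∈ exchange x → end u ≤ end x
      end-inside {x} x∈S u∈x =
        proj₂ (proj₂ (proj₂ (proj₂ (piece-⊑ (All.lookup proper x∈S) (exchanged x) u∈x))))

    exchangeAll-proper : All Proper (exchangeAll S)
    exchangeAll-proper = All.tabulate λ u∈ →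
      let x , x∈S , u∈x = origin u∈ in proj₁ (piece-⊑ (All.lookup proper x∈S) (exchanged x) u∈x)

    completion-exchangeAll-other : ∀ {i} → i ≢ j → i ≢ j' → completion i (exchangeAll S) ≤ completion i S
    completion-exchangeAll-other {i} i≢j i≢j' =
      completion-≤ (exchangeAll S) (latestEnd-nonneg (partsOf i S)) bound
      where
      bound : ∀ {u} → u ∈ exchangeAll S → job u ≡ i → end u ≤ completion i S
      bound u∈ ju with origin u∈
      ... | x , x∈S , u∈x with piece-cases (All.lookup proper x∈S) (exchanged x) u∈x
      ...   | inj₁ (refl , _)          = end≤completion x∈S ju
      ...   | inj₂ (inj₁ (ju≡j , _))   = ⊥-elim (i≢j (trans (sym ju) ju≡j))
      ...   | inj₂ (inj₂ (ju≡j' , _))  = ⊥-elim (i≢j' (trans (sym ju) ju≡j'))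

    completion-exchangeAll-j : ∀ {c} → 0ℚ < c → (∀ {x} → x ∈ S → Marked x → end x ≤ c) →
      completion j (exchangeAll S) < c
    completion-exchangeAll-j 0<c marked-early = completion-< (exchangeAll S) 0<c bound
      where
      bound : ∀ {u} → u ∈ exchangeAll S → job u ≡ j → end u < _
      bound u∈ ju with origin u∈
      ... | x , x∈S , u∈x with piece-cases (All.lookup proper x∈S) (exchanged x) u∈x
      ...   | inj₁ (refl , jx≢j)               = ⊥-elim (jx≢j ju)
      ...   | inj₂ (inj₁ (_ , mx , end<end))   = <-≤-trans end<end (marked-early x∈S mx)
      ...   | inj₂ (inj₂ (ju≡j' , _))          = ⊥-elim (j≢j' (trans (sym ju) ju≡j'))

    completion-exchangeAll-j' : completion j' (exchangeAll S) ≤ completion j S ⊔ completion j' S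
    completion-exchangeAll-j' =
      completion-≤ (exchangeAll S) (≤-trans (latestEnd-nonneg (partsOf j S)) Cj≤max) bound
      where
      Cj≤max : completion j S ≤ completion j S ⊔ completion j' S
      Cj≤max = p≤p⊔q (completion j S) (completion j' S)
      Cj'≤max : completion j' S ≤ completion j S ⊔ completion j' S
      Cj'≤max = p≤q⊔p (completion j S) (completion j' S)

      bound : ∀ {u} → u ∈ exchangeAll S → job u ≡ j' → end u ≤ completion j S ⊔ completion j' S
      bound u∈ ju with origin u∈
      ... | x , x∈S , u∈x with piece-cases (All.lookup proper x∈S) (exchanged x) u∈x
      ...   | inj₁ (refl , _)           = ≤-trans (end≤completion x∈S ju) Cj'≤max
      ...   | inj₂ (inj₁ (ju≡j , _))    = ⊥-elim (j≢j' (trans (sym ju≡j) ju))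
      ...   | inj₂ (inj₂ (_ , inj₁ jx)) =
        ≤-trans (end-inside x∈S u∈x) (≤-trans (end≤completion x∈S jx) Cj≤max)
      ...   | inj₂ (inj₂ (_ , inj₂ jx)) =
        ≤-trans (end-inside x∈S u∈x) (≤-trans (end≤completion x∈S jx) Cj'≤max)

  exchangeAll-pairwise : ∀ {S} → All Proper S → AllPairs (Compatible res) S →
    AllPairs (Compatible res) (exchangeAll S)
  exchangeAll-pairwise [] [] = []
  exchangeAll-pairwise {x ∷ S} (px ∷ proper) (x-compat ∷ pairwise) =
    AllPairs.++⁺ (exchanged-pairwise (exchanged x)) (exchangeAll-pairwise proper pairwise)
      (All.tabulate λ u∈x → All.tabulate λ v∈ →
        let y , y∈S , v∈y = ∈-concatMap⁻ exchange S v∈ in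
        compatible-⊑ res (proj₂ (piece-⊑ px (exchanged x) u∈x))
                         (proj₂ (piece-⊑ (All.lookup proper y∈S) (exchanged y) v∈y))
                         (All.lookup x-compat y∈S))

  module _ {p : Fin n → ℚ} {S : Schedule n m} (processed-S : ∀ i → processed i S ≡ p i)
           (marked-share : μ * duration (filter marked? S) ≡ p j) where

    processed-j-exchangeAll : processed j (exchangeAll S) ≡ p j
    processed-j-exchangeAll =
      trans (additive-concatMap (processed-additive j) (additive-* μ (duration-filter-additive marked?))
               exchange (λ x → processed-j-exchanged (exchanged x)) S)
            marked-share

    processed-exchangeAll : ∀ i → processed i (exchangeAll S) ≡ p i
    processed-exchangeAll i with i ≟ j | i ≟ j'
    ... | yes refl | _        = processed-j-exchangeAll
    ... | no _     | yes refl = ∙-cancelˡ (p j) (processed j' (exchangeAll S)) (p j') (begin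
      p j + processed j' (exchangeAll S)  ≡⟨ cong (_+ processed j' (exchangeAll S))
                                               processed-j-exchangeAll ⟨
      pairProcessed (exchangeAll S)       ≡⟨ additive-concatMap pairProcessed-additive pairProcessed-additive
                                               exchange (λ x → pairProcessed-exchanged (exchanged x)) S ⟩
      pairProcessed S                     ≡⟨ cong₂ _+_ (processed-S j) (processed-S j') ⟩
      p j + p j'                          ∎)
      where open ≡-Reasoning
    ... | no i≢j   | no i≢j'  =
      trans (additive-concatMap (processed-additive i) (processed-additive i)
               exchange (λ x → processed-exchanged-other i≢j i≢j' (exchanged x)) S)
            (processed-S i)

  exchangeAll-feasible : ∀ {p} S → Feasible p res S → μ * duration (filter marked? S) ≡ p j →
    Feasible p res (exchangeAll S)
  exchangeAll-feasible S feasible marked-share =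
    feasible-intro (exchangeAll-proper proper)
                   (processed-exchangeAll {S = S} (proj₁ (proj₂ feasible)) marked-share)
                   (exchangeAll-pairwise proper (feasible-pairwise res S feasible))
    where
    proper : All Proper S
    proper = feasible-proper res S feasible

module OptimalSchedule {n m k : ℕ} {p : Fin n → ℚ} (res : Fin n → Fin k) (S : Schedule n m)
  (p>0 : ∀ i → 0ℚ < p i) (optimal : Optimal p res S) (j j' : Fin n) (same-resource : res j ≡ res j') where

  private
    feasible : Feasible p res S
    feasible = proj₁ optimal

    proper : All Proper S
    proper = feasible-proper res S feasible

    processed-S : ∀ i → processed i S ≡ p i
    processed-S = proj₁ (proj₂ feasible)

    improvement-impossible : ∀ S′ → Feasible p res S′ → ¬ (totalCompletion S′ < totalCompletion S)
    improvement-impossible S′ feasible′ improvement =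
      <-irrefl refl (<-≤-trans improvement (proj₂ optimal S′ feasible′))

    completion>0 : ∀ i → 0ℚ < completion i S
    completion>0 i = completion-pos proper (subst (0ℚ <_) (sym (processed-S i)) (p>0 i))

  shorter-completes-first : p j < p j' → completion j S < completion j' S
  shorter-completes-first pj<pj' = ≰⇒> λ Cj'≤Cj →
    improvement-impossible (exchangeAll S) (exchangeAll-feasible S feasible share) (improvement Cj'≤Cj)
    where
    j≢j' : j ≢ j'
    j≢j' refl = <-irrefl refl pj<pj'

    open Fraction (p>0 j) pj<pj'
    open Exchange res j≢j' same-resource {Marked = λ x → job x ≡ j'} (λ x → job x ≟ j') (λ _ → inj₂)
                  μ>0 μ<1

    share : μ * processed j' S ≡ p j
    share = trans (cong (μ *_) (processed-S j')) μ*b≡a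

    improvement : completion j' S ≤ completion j S →
      totalCompletion (exchangeAll S) < totalCompletion S
    improvement Cj'≤Cj = sumFin-<-swap n (λ i i≢j i≢j' → completion-exchangeAll-other proper i≢j i≢j')
      (completion-exchangeAll-j proper (completion>0 j') end≤completion)
      (≤-trans (completion-exchangeAll-j' proper) (≤-reflexive (p≥q⇒p⊔q≡p Cj'≤Cj)))

  parts-precede : completion j S < completion j' S →
    ∀ {q q'} → q ∈ partsOf j S → q' ∈ partsOf j' S → end q ≤ start q'
  parts-precede Cj<Cj' {q} {q'} q∈ q'∈ = ≮⇒≥ overlap-impossible
    where
    C : ℚ
    C = completion j S

    j≢j' : j ≢ j'
    j≢j' refl = <-irrefl refl Cj<Cj'

    q∈S : q ∈ S
    q∈S = proj₁ (∈-partsOf⁻ j S q∈)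
    jq : job q ≡ j
    jq = proj₂ (∈-partsOf⁻ j S q∈)
    q'∈S : q' ∈ S
    q'∈S = proj₁ (∈-partsOf⁻ j' S q'∈)
    jq' : job q' ≡ j'
    jq' = proj₂ (∈-partsOf⁻ j' S q'∈)

    Marked : Part n m → Set
    Marked x = job x ≡ j ⊎ (job x ≡ j' × end x ≤ C)

    marked? : Decidable Marked
    marked? x = (job x ≟ j) ⊎-dec ((job x ≟ j') ×-dec (end x ≤? C))

    marked-job : ∀ x → Marked x → job x ≡ j ⊎ job x ≡ j'
    marked-job _ (inj₁ jx)       = inj₁ jx
    marked-job _ (inj₂ (jx , _)) = inj₂ jx

    marked-early : ∀ {x} → x ∈ S → Marked x → end x ≤ C
    marked-early x∈S (inj₁ jx)        = end≤completion x∈S jx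
    marked-early x∈S (inj₂ (_ , x≤C)) = x≤C

    overlap-impossible : ¬ (start q' < end q)
    overlap-impossible q'-overlaps-q =
      improvement-impossible (exchangeAll S) (exchangeAll-feasible S feasible μ*b≡a) improvement
      where
      q'-before-q : end q' ≤ start q
      q'-before-q = ≮⇒≥ λ sq<eq' →
        proj₂ (proj₂ (feasible-compatible res S feasible q∈S q'∈S (j≢j' ∘ jobs-equal ∘ cong job)))
          (j≢j' ∘ jobs-equal) (trans (cong res jq) (trans same-resource (sym (cong res jq'))))
          (sq<eq' , q'-overlaps-q)
        where
        jobs-equal : job q ≡ job q' → j ≡ j'
        jobs-equal e = trans (sym jq) (trans e jq')

      q'-early : end q' ≤ C
      q'-early = ≤-trans q'-before-q
                   (≤-trans (<⇒≤ (proj₂ (All.lookup proper q∈S))) (end≤completion q∈S jq))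

      pj<W : p j < duration (filter marked? S)
      pj<W = subst (_< duration (filter marked? S)) (processed-S j)
        (duration-filter-< (λ x → job x ≟ j) marked? inj₁ proper q'∈S (inj₂ (jq' , q'-early))
                           (λ jq'≡j → j≢j' (trans (sym jq'≡j) jq')))

      open Fraction (p>0 j) pj<W
      open Exchange res j≢j' same-resource marked? marked-job μ>0 μ<1

      improvement : totalCompletion (exchangeAll S) < totalCompletion S
      improvement = sumFin-<-pair n (λ i i≢j i≢j' → completion-exchangeAll-other proper i≢j i≢j')
        (completion-exchangeAll-j proper (completion>0 j) marked-early)
        (≤-trans (completion-exchangeAll-j' proper) (≤-reflexive (p≤q⇒p⊔q≡q (<⇒≤ Cj<Cj'))))

mainTheorem2 : (m n k : ℕ) → m ≥ 1 → (p : Fin n → ℚ) → (∀ j → 0ℚ < p j) →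
    (res : Fin n → Fin k) → (S : Schedule n m) → Optimal p res S →
    ∀ (j j' : Fin n) → res j ≡ res j' →
      (p j < p j' → completion j S < completion j' S)
      × (completion j S < completion j' S →
          ∀ q q' → q ∈ partsOf j S → q' ∈ partsOf j' S → end q ≤ start q')
mainTheorem2 _ _ _ _ p p>0 res S optimal j j' same-resource =
  shorter-completes-first , λ Cj<Cj' q q' → parts-precede Cj<Cj' {q} {q'}
  where open OptimalSchedule res S p>0 optimal j j' same-resource
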